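{- Let $k$ be an integer and let $G$ be a non-complete double-critical $k$-chromatic graph, and let $xy\in E(G)$. If $A(xy)$ is non-empty, then the induced subgraph $G[A(xy)]$ has minimum degree at least $1$ (contains no isolated vertices). Symmetrically, if $C(xy)$ is non-empty, then $G[C(xy)]$ has minimum degree at least $1$.
   Context: All graphs are finite and simple. A graph $G$ is (vertex-)critical if $\chi(G-v)<\chi(G)$ for every vertex $v$. A critical graph $G$ is double-critical if $\chi(G-x-y)\le \chi(G)-2$ for every edge $xy\in E(G)$ (here $G-x-y$ denotes deletion of both end-vertices). $N(v)$ is the open and $N[v]=N(v)\cup\{v\}$ the closed neighbourhood of $v$. For an edge $xy$: $A(xy)=N(x)\setminus N[y]$ and $C(xy)=N(y)\setminus N[x]$. -}

module Defs where

open import Data.Nat using (ℕ; _+_; _≤_; _<_)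
open import Data.Fin using (Fin)
open import Data.Bool using (Bool; true; false)
open import Data.Product using (Σ; _×_; ∃; ∃-syntax)
open import Relation.Binary.PropositionalEquality using (_≡_; _≢_)
open import Relation.Nullary using (¬_)

record Graph (n : ℕ) : Set where
  field
    adj     : Fin n → Fin n → Bool
    sym     : ∀ u v → adj u v ≡ adj v u
    irrefl  : ∀ v → adj v v ≡ false

open Graph public

Adj : ∀ {n} → Graph n → Fin n → Fin n → Set
Adj G u v = adj G u v ≡ true

Colourable : ∀ {n} → Graph n → (Fin n → Set) → ℕ → Set
Colourable {n} G S m =
  Σ (Fin n → Fin m) λ c → ∀ u v → S u → S v → Adj G u v → c u ≢ c v

AllV : ∀ {n} → Fin n → Set
AllV _ = Data.Unit.⊤
  where import Data.Unit

Minus1 : ∀ {n} → Fin n → Fin n → Set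
Minus1 x v = v ≢ x

Minus2 : ∀ {n} → Fin n → Fin n → Fin n → Set
Minus2 x y v = v ≢ x × v ≢ y

ChromaticNumber : ∀ {n} → Graph n → ℕ → Set
ChromaticNumber G k = Colourable G AllV k × (∀ m → m < k → ¬ Colourable G AllV m)

Critical : ∀ {n} → Graph n → ℕ → Set
Critical G k = ∀ v → ∃[ m ] (m < k × Colourable G (Minus1 v) m)

DoubleCriticalEdges : ∀ {n} → Graph n → ℕ → Set
DoubleCriticalEdges G k =
  ∀ x y → Adj G x y → ∃[ m ] (m + 2 ≤ k × Colourable G (Minus2 x y) m)

DoubleCritical : ∀ {n} → Graph n → ℕ → Set
DoubleCritical G k = ChromaticNumber G k × Critical G k × DoubleCriticalEdges G k

NonComplete : ∀ {n} → Graph n → Set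
NonComplete G = ∃[ u ] ∃[ v ] (u ≢ v × adj G u v ≡ false)

Aset : ∀ {n} → Graph n → Fin n → Fin n → Fin n → Set
Aset G x y v = Adj G x v × v ≢ y × ¬ Adj G y v

Cset : ∀ {n} → Graph n → Fin n → Fin n → Fin n → Set
Cset G x y v = Adj G y v × v ≢ x × ¬ Adj G x v

NonEmpty : ∀ {n} → (Fin n → Set) → Set
NonEmpty S = ∃[ v ] S v

MinDegAtLeast1 : ∀ {n} → Graph n → (Fin n → Set) → Set
MinDegAtLeast1 G S = ∀ v → S v → ∃[ w ] (S w × Adj G v w)

module Submission where

-- Let v ∈ A(xy) and suppose v has no neighbour in A(xy).  Since xv is
-- an edge, double-criticality gives a proper colouring ψ of G - x - v with m colours,
-- m + 2 ≤ k.  Let T consist of v together with every neighbour u ≠ x of x with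
-- ψ u = ψ y (so y ∈ T).  Such a u ≠ y is not adjacent to y (same ψ-colour), hence
-- lies in A(xy), hence is not adjacent to v; so T is independent.  Outside T, ψ
-- extended by giving x the colour ψ y is proper, because every neighbour of x with
-- ψ-colour ψ y has been moved into T.  Using T as one extra colour class yields a
-- proper (m + 1)-colouring of G, contradicting χ(G) = k > m + 1.

open import Defs
open import Data.Nat using (ℕ; suc; _≤_)
open import Data.Nat.Properties using (+-comm)
open import Data.Fin using (Fin; zero; suc; _≟_)
open import Data.Fin.Properties using (any?; suc-injective)
open import Data.Bool using (true)
import Data.Bool.Properties as Bool
open import Data.Product using (_×_; _,_; proj₁; proj₂)
open import Data.Sum using (_⊎_; inj₁; inj₂; fromInj₂)
open import Function using (_∘_)
open import Data.Empty using (⊥-elim)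
open import Relation.Nullary using (¬_; Dec; yes; no)
open import Relation.Nullary.Decidable using (_×-dec_; _⊎-dec_; ¬?)
open import Relation.Unary using (Decidable)
open import Relation.Binary.PropositionalEquality
  using (_≡_; _≢_; refl; trans; subst) renaming (sym to ≡-sym)

module _ {n : ℕ} (G : Graph n) where

  adj-sym : ∀ {u w} → Adj G u w → Adj G w u
  adj-sym {u} {w} a = trans (Graph.sym G w u) a

  no-loop : ∀ {u} → ¬ Adj G u u
  no-loop {u} a with trans (≡-sym a) (irrefl G u)
  ... | ()

  adj? : ∀ u w → Dec (Adj G u w)
  adj? u w = adj G u w Bool.≟ true

  Proper : ∀ {m} → (Fin n → Set) → (Fin n → Fin m) → Set
  Proper S ψ = ∀ u w → S u → S w → Adj G u w → ψ u ≢ ψ w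

  Independent : (Fin n → Set) → Set
  Independent I = ∀ u w → I u → I w → ¬ Adj G u w

  restrict : ∀ {S S' : Fin n → Set} {m} →
             (∀ u → S' u → S u) → Colourable G S m → Colourable G S' m
  restrict S'⊆S (ψ , proper) =
    ψ , λ u w s'u s'w → proper u w (S'⊆S u s'u) (S'⊆S w s'w)

  recolour : ∀ {m} → (Fin n → Fin m) → Fin n → Fin m → Fin n → Fin m
  recolour ψ x j u with u ≟ x
  ... | yes _ = j
  ... | no _  = ψ u

  private
    other : ∀ {S : Fin n → Set} {x z} → z ≢ x → z ≡ x ⊎ S z → S z
    other z≢x = fromInj₂ (⊥-elim ∘ z≢x)

  recolour-proper : ∀ {S : Fin n → Set} {m} (ψ : Fin n → Fin m) (x : Fin n) (j : Fin m) →
    Proper S ψ → (∀ w → S w → Adj G x w → ψ w ≢ j) →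
    Proper (λ u → u ≡ x ⊎ S u) (recolour ψ x j)
  recolour-proper {S} ψ x j proper free u w su sw a with u ≟ x | w ≟ x
  ... | yes refl | yes refl = λ _ → no-loop a
  ... | yes refl | no w≢x   = λ j≡ψw → free w (other {S} w≢x sw) a (≡-sym j≡ψw)
  ... | no u≢x   | yes refl = free u (other {S} u≢x su) (adj-sym a)
  ... | no u≢x   | no w≢x   = proper u w (other {S} u≢x su) (other {S} w≢x sw) a

  add-colour-class : ∀ {I : Fin n → Set} {m} → Decidable I → Independent I →
    Colourable G (λ u → ¬ I u) m → Colourable G AllV (suc m)
  add-colour-class {I} {m} I? independent (ψ , proper) = colour , colour-proper
    where
      colour : Fin n → Fin (suc m)
      colour u with I? u
      ... | yes _ = zero
      ... | no _  = suc (ψ u)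

      colour-proper : Proper AllV colour
      colour-proper u w _ _ a with I? u | I? w
      ... | yes iu | yes iw = λ _ → independent u w iu iw a
      ... | yes _  | no _   = λ ()
      ... | no _   | yes _  = λ ()
      ... | no ¬iu | no ¬iw = λ eq → proper u w ¬iu ¬iw a (suc-injective eq)

  module Recolouring (x y v : Fin n) (xy : Adj G x y) (v∈A : Aset G x y v)
                     (v-isolated : ∀ w → Aset G x y w → ¬ Adj G v w)
                     {m : ℕ} (ψ : Fin n → Fin m) (proper : Proper (Minus2 x v) ψ) where

    T : Fin n → Set
    T u = u ≡ v ⊎ (u ≢ x × Adj G x u × ψ u ≡ ψ y)

    T? : Decidable T
    T? u = (u ≟ v) ⊎-dec (¬? (u ≟ x) ×-dec adj? x u ×-dec (ψ u ≟ ψ y))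

    y∈G-x-v : Minus2 x v y
    y∈G-x-v = (λ { refl → no-loop xy }) , (λ { refl → proj₁ (proj₂ v∈A) refl })

    same-colour-as-y : ∀ {w} → Minus2 x v w → ψ w ≡ ψ y → ¬ Adj G y w
    same-colour-as-y w∈ ψw≡ψy a = proper _ _ w∈ y∈G-x-v (adj-sym a) ψw≡ψy

    -- v has no neighbour in T: y is not a neighbour as v ∈ A(xy), and every other
    -- member of T lies in A(xy).
    v-misses-T : ∀ w → T w → ¬ Adj G v w
    v-misses-T w (inj₁ refl) a = no-loop a
    v-misses-T w (inj₂ (w≢x , xw , ψw≡ψy)) a with w ≟ y
    ... | yes refl = proj₂ (proj₂ v∈A) (adj-sym a)
    ... | no w≢y   = v-isolated w (xw , w≢y , same-colour-as-y w∈ ψw≡ψy) a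
      where w∈ : Minus2 x v w
            w∈ = w≢x , λ { refl → no-loop a }

    T-independent : Independent T
    T-independent u w (inj₁ refl) tw a = v-misses-T w tw a
    T-independent u w tu (inj₁ refl) a = v-misses-T u tu (adj-sym a)
    T-independent u w (inj₂ (u≢x , xu , ψu≡ψy)) (inj₂ (w≢x , xw , ψw≡ψy)) a
      with u ≟ v | w ≟ v
    ... | yes refl | _        = v-misses-T w (inj₂ (w≢x , xw , ψw≡ψy)) a
    ... | no _     | yes refl = v-misses-T u (inj₂ (u≢x , xu , ψu≡ψy)) (adj-sym a)
    ... | no u≢v   | no w≢v   =
      proper u w (u≢x , u≢v) (w≢x , w≢v) a (trans ψu≡ψy (≡-sym ψw≡ψy))

    -- Outside T, colour x with ψ y; its neighbours of that colour all lie in T.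
    colouring-outside-T : Colourable G (λ u → ¬ T u) m
    colouring-outside-T = restrict outside-T⊆x∪S
      (recolour ψ x (ψ y) , recolour-proper ψ x (ψ y) proper-on-S x-colour-free)
      where
        S : Fin n → Set
        S u = Minus2 x v u × ¬ T u

        proper-on-S : Proper S ψ
        proper-on-S u w su sw = proper u w (proj₁ su) (proj₁ sw)

        x-colour-free : ∀ w → S w → Adj G x w → ψ w ≢ ψ y
        x-colour-free w ((w≢x , _) , w∉T) xw ψw≡ψy = w∉T (inj₂ (w≢x , xw , ψw≡ψy))

        outside-T⊆x∪S : ∀ u → ¬ T u → u ≡ x ⊎ S u
        outside-T⊆x∪S u u∉T with u ≟ x
        ... | yes u≡x = inj₁ u≡x
        ... | no u≢x  = inj₂ ((u≢x , λ u≡v → u∉T (inj₁ u≡v)) , u∉T)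

    colouring : Colourable G AllV (suc m)
    colouring = add-colour-class T? T-independent colouring-outside-T

  A? : ∀ x y → Decidable (Aset G x y)
  A? x y w = adj? x w ×-dec ¬? (w ≟ y) ×-dec ¬? (adj? y w)

  -- In a double-critical k-chromatic graph every vertex of A(xy) has a neighbour
  -- in A(xy): otherwise the recolouring above colours G with fewer than k colours.
  A-has-no-isolated-vertex : ∀ k → DoubleCritical G k → ∀ x y → Adj G x y →
    MinDegAtLeast1 G (Aset G x y)
  A-has-no-isolated-vertex k ((_ , fewer-colours-fail) , _ , double-critical) x y xy v v∈A
    with any? (λ w → A? x y w ×-dec adj? v w)
  ... | yes (w , w∈A , vw) = w , w∈A , vw
  ... | no no-neighbour with double-critical x v (proj₁ v∈A)
  ...   | m , m+2≤k , ψ , proper =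
          ⊥-elim (fewer-colours-fail (suc m) (subst (_≤ k) (+-comm m 2) m+2≤k)
            (Recolouring.colouring x y v xy v∈A
               (λ w w∈A vw → no-neighbour (w , w∈A , vw)) ψ proper))

-- Proposition 9.  The statement about C(xy) is the one about A(yx).
proposition9 : ∀ {n} (k : ℕ) (G : Graph n) → NonComplete G → DoubleCritical G k →
    ∀ (x y : Fin n) → Adj G x y →
    (NonEmpty (Aset G x y) → MinDegAtLeast1 G (Aset G x y)) ×
    (NonEmpty (Cset G x y) → MinDegAtLeast1 G (Cset G x y))
proposition9 k G _ dc x y xy =
  (λ _ → A-has-no-isolated-vertex G k dc x y xy) ,
  (λ _ → A-has-no-isolated-vertex G k dc y x (adj-sym G xy))
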